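{- Let $n \ge 1$. If $U \subseteq \mathbb{Z}_3^n$ is isomorphic to $D_n$ and $A_n \cap U = \emptyset$, then $|U \cap B_n| = |U \cap C_n| = |U|/2$.
   Context: $H(n,3)$ is the Hamming graph on $\mathbb{Z}_3^n$ (vertices adjacent iff they differ in exactly one coordinate). Two subsets of $\mathbb{Z}_3^n$ are isomorphic if some graph automorphism of $H(n,3)$ maps one onto the other. $A_n, B_n, C_n$ are the sets of $x \in \mathbb{Z}_3^n$ with $\sum_i x_i \equiv 0, 1, 2 \pmod 3$ respectively. For $S \subseteq \mathbb{Z}_3^{n}$ and $c \in \mathbb{Z}_3$, $(S,c) = \{(x_1,\dots,x_{n},c) : (x_1,\dots,x_n) \in S\}$. The sets $D_n$ are defined by $D_1 = \{1,2\}$ and $D_{n+1} = (D_n,0) \cup (A_n,1) \cup (A_n,2)$. -}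

module Defs where

open import Data.Nat using (ℕ; zero; suc; _+_; _%_)
open import Data.Fin using (Fin; toℕ) renaming (zero to f0; suc to fs)
open import Data.Fin.Properties using (_≟_)
open import Data.Vec using (Vec; []; _∷_; init; last; foldr)
open import Data.List using (List; []; _∷_; concatMap; map; filter; length)
open import Data.Bool using (Bool; true; false; _∧_; _∨_; not; if_then_else_)
open import Relation.Nullary.Decidable using (⌊_⌋)
open import Relation.Binary.PropositionalEquality using (_≡_)
open import Function.Bundles using (_↔_; Inverse; _⇔_)

Word : ℕ → Set
Word n = Vec (Fin 3) n

Subset : ℕ → Set
Subset n = Word n → Bool

dist : ∀ {n} → Word n → Word n → ℕ
dist [] [] = 0
dist (a ∷ x) (b ∷ y) = (if ⌊ a ≟ b ⌋ then 0 else 1) + dist x y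

Adj : ∀ {n} → Word n → Word n → Set
Adj x y = dist x y ≡ 1

record Automorphism (n : ℕ) : Set where
  field
    bij      : Word n ↔ Word n
    preserve : ∀ x y → Adj x y ⇔ Adj (Inverse.to bij x) (Inverse.to bij y)

Isomorphic : ∀ {n} → Subset n → Subset n → Set
Isomorphic {n} U V = Σ' (Automorphism n) λ σ → ∀ x → U (Inverse.to (Automorphism.bij σ) x) ≡ V x
  where
  open import Data.Product using () renaming (Σ to Σ')

sum3 : ∀ {n} → Word n → ℕ
sum3 x = foldr _ (λ a s → toℕ a + s) 0 x % 3

isRes : ℕ → ∀ {n} → Subset n
isRes r x = ⌊ sum3 x Data.Nat.≟ r ⌋

A B C : ∀ {n} → Subset n
A = isRes 0
B = isRes 1
C = isRes 2

-- D_1 = {1,2},  D_{n+1} = (D_n,0) ∪ (A_n,1) ∪ (A_n,2); (S,c) appends c as last coordinate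
-- D' m is D_{m+1}
D' : (m : ℕ) → Subset (suc m)
D' zero (a ∷ []) = not ⌊ a ≟ f0 ⌋
D' (suc m) x = lastCase (last x)
  where
  lastCase : Fin 3 → Bool
  lastCase f0 = D' m (init x)
  lastCase (fs _) = A (init x)

D : (n : ℕ) → .{{_ : Data.Nat.NonZero n}} → Subset n
D (suc m) = D' m

allWords : (n : ℕ) → List (Word n)
allWords zero = [] ∷ []
allWords (suc n) = concatMap (λ w → map (_∷ w) (f0 ∷ fs f0 ∷ fs (fs f0) ∷ [])) (allWords n)

card : ∀ {n} → Subset n → ℕ
card {n} U = length (filter (λ x → U x Data.Bool.≟ true) (allWords n))

_∩_ : ∀ {n} → Subset n → Subset n → Subset n
(U ∩ V) x = U x ∧ V x

{-# OPTIONS --safe #-}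
module Submission where

-- Adjacent words of ℤ₃ⁿ have different coordinate sums mod 3. D_n induces a perfect matching
-- of H(n,3) (every point of D_n has exactly one neighbour in D_n), and so does every U ≅ D_n.
-- If U misses A_n, the partner of a point of U ∩ B_n has a sum that is neither 0 nor 1, so it
-- lies in U ∩ C_n, and vice versa; double counting the matching edges gives |U ∩ B_n| = |U ∩ C_n|,
-- and U is the disjoint union of U ∩ B_n and U ∩ C_n.

open import Defs
open import Algebra.Bundles using (CommutativeMonoid)
open import Algebra.Properties.CommutativeSemigroup using (x∙yz≈y∙xz; interchange)
open import Data.Bool using (Bool; true; false; _∧_; if_then_else_)
import Data.Bool as Bool
open import Data.Bool.Properties using (T-≡; ∧-conicalˡ; ∧-conicalʳ; ∧-commutativeMonoid)
open import Data.Fin using (Fin; toℕ; opposite; suc)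
open import Data.Fin.Patterns using (0F; 1F; 2F)
open import Data.Fin.Properties using (_≟_; toℕ-injective; toℕ<n) renaming (suc-injective to suc-injectiveᶠ)
open import Data.List using (List; []; _∷_; _++_; map; filter; length; concatMap)
open import Data.List.Properties using (map-cong; map-++)
open import Data.Nat using (ℕ; zero; suc; _+_; _*_; _%_)
import Data.Nat as ℕ
open import Data.Nat.DivMod using (%-distribˡ-+; m<n⇒m%n≡m)
open import Data.Nat.ListAction using (sum)
open import Data.Nat.ListAction.Properties using (sum-++)
open import Data.Nat.Properties using (+-identityʳ; suc-injective; +-commutativeSemigroup)
open import Data.Product using (_×_; _,_; ∃!)
open import Data.Sum using (_⊎_; inj₁; inj₂)
open import Data.Vec using ([]; _∷_; _∷ʳ_; initLast)
open import Data.Vec.Properties using (init-∷ʳ; last-∷ʳ; ≡-dec)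
open import Function using (_∘_)
open import Function.Bundles using (Inverse; Equivalence; mk⇔)
open import Relation.Binary.Definitions using (DecidableEquality)
open import Relation.Binary.PropositionalEquality
  using (_≡_; _≢_; refl; sym; trans; cong; cong₂; subst; subst₂; module ≡-Reasoning)
open import Relation.Nullary using (yes; no; does; contradiction)
open import Relation.Nullary.Decidable using (⌊_⌋; toWitness; fromWitness; isYes≗does; does-⇔)

open ≡-Reasoning

-- ℤ₃ and coordinate sums

rotate : Fin 3 → Fin 3
rotate 0F = 1F
rotate 1F = 2F
rotate 2F = 0F

-- Every translation b ↦ a ⊕ b is a power of rotate, so translations commute by computation.
infixr 6 _⊕_
_⊕_ : Fin 3 → Fin 3 → Fin 3
0F ⊕ b = b
1F ⊕ b = rotate b
2F ⊕ b = rotate (rotate b)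

-_ : Fin 3 → Fin 3
- 0F = 0F
- 1F = 2F
- 2F = 1F

⊕-identityʳ : ∀ a → a ⊕ 0F ≡ a
⊕-identityʳ 0F = refl
⊕-identityʳ 1F = refl
⊕-identityʳ 2F = refl

⊕-leftComm : ∀ a b c → a ⊕ b ⊕ c ≡ b ⊕ a ⊕ c
⊕-leftComm 0F b  c = refl
⊕-leftComm a  0F c = refl
⊕-leftComm 1F 1F c = refl
⊕-leftComm 1F 2F c = refl
⊕-leftComm 2F 1F c = refl
⊕-leftComm 2F 2F c = refl

⊕-comm : ∀ a b → a ⊕ b ≡ b ⊕ a
⊕-comm a b = begin
  a ⊕ b        ≡⟨ cong (a ⊕_) (⊕-identityʳ b) ⟨
  a ⊕ b ⊕ 0F   ≡⟨ ⊕-leftComm a b 0F ⟩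
  b ⊕ a ⊕ 0F   ≡⟨ cong (b ⊕_) (⊕-identityʳ a) ⟩
  b ⊕ a        ∎

rotate³ : ∀ a → rotate (rotate (rotate a)) ≡ a
rotate³ 0F = refl
rotate³ 1F = refl
rotate³ 2F = refl

rotate-injective : ∀ {a b} → rotate a ≡ rotate b → a ≡ b
rotate-injective {a} {b} eq = begin
  a                            ≡⟨ rotate³ a ⟨
  rotate (rotate (rotate a))   ≡⟨ cong (rotate ∘ rotate) eq ⟩
  rotate (rotate (rotate b))   ≡⟨ rotate³ b ⟩
  b                            ∎

⊕-cancelˡ : ∀ a {b c} → a ⊕ b ≡ a ⊕ c → b ≡ c
⊕-cancelˡ 0F eq = eq
⊕-cancelˡ 1F eq = rotate-injective eq
⊕-cancelˡ 2F eq = rotate-injective (rotate-injective eq)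

⊕-cancelʳ : ∀ {a b} c → a ⊕ c ≡ b ⊕ c → a ≡ b
⊕-cancelʳ {a} {b} c eq = ⊕-cancelˡ c (trans (⊕-comm c a) (trans eq (⊕-comm b c)))

toℕ-⊕ : ∀ a b → toℕ (a ⊕ b) ≡ (toℕ a + toℕ b) % 3
toℕ-⊕ 0F 0F = refl
toℕ-⊕ 0F 1F = refl
toℕ-⊕ 0F 2F = refl
toℕ-⊕ 1F 0F = refl
toℕ-⊕ 1F 1F = refl
toℕ-⊕ 1F 2F = refl
toℕ-⊕ 2F 0F = refl
toℕ-⊕ 2F 1F = refl
toℕ-⊕ 2F 2F = refl

distinct-nonzero⇒≡- : ∀ {a b} → a ≢ 0F → b ≢ 0F → a ≢ b → b ≡ - a
distinct-nonzero⇒≡- {0F}      a≢0 _   _   = contradiction refl a≢0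
distinct-nonzero⇒≡- {_}  {0F} _   b≢0 _   = contradiction refl b≢0
distinct-nonzero⇒≡- {1F} {1F} _   _   a≢b = contradiction refl a≢b
distinct-nonzero⇒≡- {1F} {2F} _   _   _   = refl
distinct-nonzero⇒≡- {2F} {1F} _   _   _   = refl
distinct-nonzero⇒≡- {2F} {2F} _   _   a≢b = contradiction refl a≢b

residue : ∀ {n} → Word n → Fin 3
residue []      = 0F
residue (a ∷ x) = a ⊕ residue x

residue-∷ʳ : ∀ {n} (xs : Word n) a → residue (xs ∷ʳ a) ≡ a ⊕ residue xs
residue-∷ʳ []       a = refl
residue-∷ʳ (x ∷ xs) a = trans (cong (x ⊕_) (residue-∷ʳ xs a)) (⊕-leftComm x a (residue xs))

sum3≡toℕ-residue : ∀ {n} (x : Word n) → sum3 x ≡ toℕ (residue x)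
sum3≡toℕ-residue []      = refl
sum3≡toℕ-residue (a ∷ x) = begin
  sum3 (a ∷ x)                                ≡⟨ %-distribˡ-+ (toℕ a) _ 3 ⟩
  (toℕ a % 3 + sum3 x) % 3                    ≡⟨ cong (λ s → (toℕ a % 3 + s) % 3) reduced ⟩
  (toℕ a % 3 + toℕ (residue x) % 3) % 3       ≡⟨ %-distribˡ-+ (toℕ a) (toℕ (residue x)) 3 ⟨
  (toℕ a + toℕ (residue x)) % 3               ≡⟨ toℕ-⊕ a (residue x) ⟨
  toℕ (a ⊕ residue x)                         ∎
  where
  reduced : sum3 x ≡ toℕ (residue x) % 3
  reduced = trans (sum3≡toℕ-residue x) (sym (m<n⇒m%n≡m (toℕ<n (residue x))))

⌊toℕ-≟⌋ : ∀ {k} (a b : Fin k) → ⌊ toℕ a ℕ.≟ toℕ b ⌋ ≡ ⌊ a ≟ b ⌋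
⌊toℕ-≟⌋ a b = begin
  ⌊ toℕ a ℕ.≟ toℕ b ⌋      ≡⟨ isYes≗does _ ⟩
  does (toℕ a ℕ.≟ toℕ b)   ≡⟨ does-⇔ (mk⇔ toℕ-injective (cong toℕ)) (toℕ a ℕ.≟ toℕ b) (a ≟ b) ⟩
  does (a ≟ b)             ≡⟨ isYes≗does _ ⟨
  ⌊ a ≟ b ⌋                ∎

isRes-toℕ : ∀ {n} r (x : Word n) → isRes (toℕ r) x ≡ ⌊ residue x ≟ r ⌋
isRes-toℕ r x = trans (cong (λ s → ⌊ s ℕ.≟ toℕ r ⌋) (sum3≡toℕ-residue x)) (⌊toℕ-≟⌋ (residue x) r)

isRes⇒residue≡ : ∀ {n} r (x : Word n) → isRes (toℕ r) x ≡ true → residue x ≡ r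
isRes⇒residue≡ r x x∈ = toWitness (Equivalence.from T-≡ (trans (sym (isRes-toℕ r x)) x∈))

residue≡⇒isRes : ∀ {n} r (x : Word n) → residue x ≡ r → isRes (toℕ r) x ≡ true
residue≡⇒isRes r x eq = trans (isRes-toℕ r x) (Equivalence.to T-≡ (fromWitness eq))

-- Hamming adjacency

dist-self : ∀ {n} (x : Word n) → dist x x ≡ 0
dist-self []      = refl
dist-self (a ∷ x) with a ≟ a
... | yes _   = dist-self x
... | no a≢a  = contradiction refl a≢a

dist≡0⇒≡ : ∀ {n} {x y : Word n} → dist x y ≡ 0 → x ≡ y
dist≡0⇒≡ {x = []}    {[]}    _ = refl
dist≡0⇒≡ {x = a ∷ x} {b ∷ y} d≡0 with a ≟ b
... | yes refl = cong (a ∷_) (dist≡0⇒≡ d≡0)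

dist-sym : ∀ {n} (x y : Word n) → dist x y ≡ dist y x
dist-sym []      []      = refl
dist-sym (a ∷ x) (b ∷ y) with a ≟ b | b ≟ a
... | yes _   | yes _   = dist-sym x y
... | no _    | no _    = cong suc (dist-sym x y)
... | yes a≡b | no b≢a  = contradiction (sym a≡b) b≢a
... | no a≢b  | yes b≡a = contradiction (sym b≡a) a≢b

mismatch : Fin 3 → Fin 3 → ℕ
mismatch a b = if ⌊ a ≟ b ⌋ then 0 else 1

dist-∷ʳ : ∀ {n} (xs ys : Word n) {a b} → dist (xs ∷ʳ a) (ys ∷ʳ b) ≡ dist (a ∷ xs) (b ∷ ys)
dist-∷ʳ []       []       = refl
dist-∷ʳ (x ∷ xs) (y ∷ ys) {a} {b} =
  trans (cong (mismatch x y +_) (dist-∷ʳ xs ys))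
        (x∙yz≈y∙xz +-commutativeSemigroup (mismatch x y) (mismatch a b) (dist xs ys))

Adj-∷-inv : ∀ {n} a b (x y : Word n) → Adj (a ∷ x) (b ∷ y) → (a ≡ b × Adj x y) ⊎ (a ≢ b × x ≡ y)
Adj-∷-inv a b x y x~y with a ≟ b
... | yes a≡b = inj₁ (a≡b , x~y)
... | no a≢b  = inj₂ (a≢b , dist≡0⇒≡ (suc-injective x~y))

Adj-∷ʳ-inv : ∀ {n a b} (xs ys : Word n) → Adj (xs ∷ʳ a) (ys ∷ʳ b) →
             (a ≡ b × Adj xs ys) ⊎ (a ≢ b × xs ≡ ys)
Adj-∷ʳ-inv {a = a} {b} xs ys x~y = Adj-∷-inv a b xs ys (trans (sym (dist-∷ʳ xs ys)) x~y)

Adj-∷-tail : ∀ {n} a (x y : Word n) → Adj x y → Adj (a ∷ x) (a ∷ y)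
Adj-∷-tail a x y x~y with a ≟ a
... | yes _   = x~y
... | no a≢a  = contradiction refl a≢a

Adj-∷-head : ∀ {n a b} (x : Word n) → a ≢ b → Adj (a ∷ x) (b ∷ x)
Adj-∷-head {a = a} {b} x a≢b with a ≟ b
... | yes a≡b = contradiction a≡b a≢b
... | no _    = cong suc (dist-self x)

Adj-∷ʳ-init : ∀ {n} a (xs ys : Word n) → Adj xs ys → Adj (xs ∷ʳ a) (ys ∷ʳ a)
Adj-∷ʳ-init a xs ys xs~ys = trans (dist-∷ʳ xs ys) (Adj-∷-tail a xs ys xs~ys)

Adj-∷ʳ-last : ∀ {n a b} (xs : Word n) → a ≢ b → Adj (xs ∷ʳ a) (xs ∷ʳ b)
Adj-∷ʳ-last xs a≢b = trans (dist-∷ʳ xs xs) (Adj-∷-head xs a≢b)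

Adj⇒residue≢ : ∀ {n} (x y : Word n) → Adj x y → residue x ≢ residue y
Adj⇒residue≢ []      []      ()
Adj⇒residue≢ (a ∷ x) (b ∷ y) x~y with Adj-∷-inv a b x y x~y
... | inj₁ (refl , x~y') = Adj⇒residue≢ x y x~y' ∘ ⊕-cancelˡ a
... | inj₂ (a≢b , refl)  = a≢b ∘ ⊕-cancelʳ (residue x)

-- Perfect matchings induced by D_n and its images

NeighbourIn : ∀ {n} → Subset n → Word n → Word n → Set
NeighbourIn S x y = Adj x y × S y ≡ true

InducesPerfectMatching : ∀ {n} → Subset n → Set
InducesPerfectMatching S = ∀ x → S x ≡ true → ∃! _≡_ (NeighbourIn S x)

module _ {n} (σ : Automorphism n) where
  open Inverse (Automorphism.bij σ)
  open Automorphism σ using (preserve)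

  private
    to-Adj : ∀ {x y} → Adj x y → Adj (to x) (to y)
    to-Adj {x} {y} = Equivalence.to (preserve x y)

    from-Adj : ∀ {x y} → Adj x y → Adj (from x) (from y)
    from-Adj {x} {y} x~y = Equivalence.from (preserve (from x) (from y))
      (subst₂ Adj (sym (strictlyInverseˡ x)) (sym (strictlyInverseˡ y)) x~y)

  inducesPerfectMatching-pullback : ∀ {U V} → (∀ x → U (to x) ≡ V x) →
                                    InducesPerfectMatching V → InducesPerfectMatching U
  inducesPerfectMatching-pullback {U} {V} U∘σ≗V V-matched x x∈U = lift (V-matched (from x) (from-∈ x∈U))
    where
    from-∈ : ∀ {z} → U z ≡ true → V (from z) ≡ true
    from-∈ {z} z∈U = trans (sym (U∘σ≗V (from z))) (trans (cong U (strictlyInverseˡ z)) z∈U)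

    lift : ∃! _≡_ (NeighbourIn V (from x)) → ∃! _≡_ (NeighbourIn U x)
    lift (y , (σ⁻¹x~y , y∈V) , unique) =
      to y , (x~σy , trans (U∘σ≗V y) y∈V) ,
      λ (x~z , z∈U) → trans (cong to (unique (from-Adj x~z , from-∈ z∈U))) (strictlyInverseˡ _)
      where
      x~σy : Adj x (to y)
      x~σy = subst (λ w → Adj w (to y)) (strictlyInverseˡ x) (to-Adj σ⁻¹x~y)

∷ʳ-elim : ∀ {n} {P : Word (suc n) → Set} → (∀ xs a → P (xs ∷ʳ a)) → ∀ x → P x
∷ʳ-elim f x with initLast x
... | xs , a , refl = f xs a

D'-∷ʳ-0F : ∀ m (xs : Word (suc m)) → D' (suc m) (xs ∷ʳ 0F) ≡ D' m xs
D'-∷ʳ-0F m xs rewrite last-∷ʳ 0F xs | init-∷ʳ 0F xs = refl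

D'-∷ʳ-suc : ∀ m (xs : Word (suc m)) k → D' (suc m) (xs ∷ʳ suc k) ≡ A xs
D'-∷ʳ-suc m xs k rewrite last-∷ʳ (suc k) xs | init-∷ʳ (suc k) xs = refl

∈D'-∷ʳ-0F : ∀ m (xs : Word (suc m)) → D' (suc m) (xs ∷ʳ 0F) ≡ true → D' m xs ≡ true
∈D'-∷ʳ-0F m xs = trans (sym (D'-∷ʳ-0F m xs))

∈D'-∷ʳ-suc : ∀ m (xs : Word (suc m)) k → D' (suc m) (xs ∷ʳ suc k) ≡ true → residue xs ≡ 0F
∈D'-∷ʳ-suc m xs k = isRes⇒residue≡ 0F xs ∘ trans (sym (D'-∷ʳ-suc m xs k))

D'⇒residue≢0 : ∀ m (x : Word (suc m)) → D' m x ≡ true → residue x ≢ 0F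
D'⇒residue≢0 zero    (0F ∷ []) ()
D'⇒residue≢0 zero    (1F ∷ []) _ ()
D'⇒residue≢0 zero    (2F ∷ []) _ ()
D'⇒residue≢0 (suc m) = ∷ʳ-elim last-case
  where
  last-case : ∀ xs a → D' (suc m) (xs ∷ʳ a) ≡ true → residue (xs ∷ʳ a) ≢ 0F
  last-case xs 0F x∈D = D'⇒residue≢0 m xs (∈D'-∷ʳ-0F m xs x∈D) ∘ trans (sym (residue-∷ʳ xs 0F))
  last-case xs (suc k) x∈D
    rewrite residue-∷ʳ xs (suc k) | ∈D'-∷ʳ-suc m xs k x∈D | ⊕-identityʳ (suc k) = λ ()

opposite-≢ : (k : Fin 2) → k ≢ opposite k
opposite-≢ 0F ()
opposite-≢ 1F ()

≢⇒≡opposite : {j k : Fin 2} → j ≢ k → j ≡ opposite k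
≢⇒≡opposite {0F} {0F} j≢k = contradiction refl j≢k
≢⇒≡opposite {0F} {1F} _   = refl
≢⇒≡opposite {1F} {0F} _   = refl
≢⇒≡opposite {1F} {1F} j≢k = contradiction refl j≢k

module _ (m : ℕ) where

  ∃!-neighbour-∷ʳ-0F : ∀ xs → D' m xs ≡ true → ∃! _≡_ (NeighbourIn (D' m) xs) →
                       ∃! _≡_ (NeighbourIn (D' (suc m)) (xs ∷ʳ 0F))
  ∃!-neighbour-∷ʳ-0F xs xs∈D (ys , (xs~ys , ys∈D) , unique) =
    ys ∷ʳ 0F , (Adj-∷ʳ-init 0F xs ys xs~ys , trans (D'-∷ʳ-0F m ys) ys∈D) , λ {z} → ∷ʳ-elim unique-∷ʳ z
    where
    unique-∷ʳ : ∀ zs b → NeighbourIn (D' (suc m)) (xs ∷ʳ 0F) (zs ∷ʳ b) → ys ∷ʳ 0F ≡ zs ∷ʳ b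
    unique-∷ʳ zs 0F (x~z , z∈D) with Adj-∷ʳ-inv xs zs x~z
    ... | inj₁ (_ , xs~zs) = cong (_∷ʳ 0F) (unique (xs~zs , ∈D'-∷ʳ-0F m zs z∈D))
    ... | inj₂ (0≢0 , _)   = contradiction refl 0≢0
    unique-∷ʳ zs (suc k) (x~z , z∈D) with Adj-∷ʳ-inv xs zs x~z
    ... | inj₂ (_ , refl) = contradiction (∈D'-∷ʳ-suc m xs k z∈D) (D'⇒residue≢0 m xs xs∈D)

  ∃!-neighbour-∷ʳ-suc : ∀ xs k → A xs ≡ true → ∃! _≡_ (NeighbourIn (D' (suc m)) (xs ∷ʳ suc k))
  ∃!-neighbour-∷ʳ-suc xs k xs∈A =
    xs ∷ʳ suc (opposite k) ,
    (Adj-∷ʳ-last xs (opposite-≢ k ∘ suc-injectiveᶠ) , trans (D'-∷ʳ-suc m xs (opposite k)) xs∈A) ,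
    λ {z} → ∷ʳ-elim unique-∷ʳ z
    where
    unique-∷ʳ : ∀ zs b → NeighbourIn (D' (suc m)) (xs ∷ʳ suc k) (zs ∷ʳ b) →
                xs ∷ʳ suc (opposite k) ≡ zs ∷ʳ b
    unique-∷ʳ zs 0F (x~z , z∈D) with Adj-∷ʳ-inv xs zs x~z
    ... | inj₂ (_ , refl) =
      contradiction (isRes⇒residue≡ 0F xs xs∈A) (D'⇒residue≢0 m xs (∈D'-∷ʳ-0F m xs z∈D))
    unique-∷ʳ zs (suc j) (x~z , z∈D) with Adj-∷ʳ-inv xs zs x~z
    ... | inj₁ (refl , xs~zs) =
      contradiction (trans (isRes⇒residue≡ 0F xs xs∈A) (sym (∈D'-∷ʳ-suc m zs k z∈D)))
                    (Adj⇒residue≢ xs zs xs~zs)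
    ... | inj₂ (k≢j , refl) = cong (λ i → xs ∷ʳ suc i) (sym (≢⇒≡opposite (k≢j ∘ cong suc ∘ sym)))

D'-inducesPerfectMatching : ∀ m → InducesPerfectMatching (D' m)
D'-inducesPerfectMatching zero (0F ∷ []) ()
D'-inducesPerfectMatching zero (1F ∷ []) _ =
  2F ∷ [] , (refl , refl) , λ { {0F ∷ []} (_ , ()) ; {1F ∷ []} (() , _) ; {2F ∷ []} _ → refl }
D'-inducesPerfectMatching zero (2F ∷ []) _ =
  1F ∷ [] , (refl , refl) , λ { {0F ∷ []} (_ , ()) ; {1F ∷ []} _ → refl ; {2F ∷ []} (() , _) }
D'-inducesPerfectMatching (suc m) = ∷ʳ-elim last-case
  where
  last-case : ∀ xs a → D' (suc m) (xs ∷ʳ a) ≡ true → ∃! _≡_ (NeighbourIn (D' (suc m)) (xs ∷ʳ a))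
  last-case xs 0F x∈D =
    let xs∈D = ∈D'-∷ʳ-0F m xs x∈D in ∃!-neighbour-∷ʳ-0F m xs xs∈D (D'-inducesPerfectMatching m xs xs∈D)
  last-case xs (suc k) x∈D = ∃!-neighbour-∷ʳ-suc m xs k (trans (sym (D'-∷ʳ-suc m xs k)) x∈D)

-- Double counting

private
  variable
    X Y : Set

𝟙 : Bool → ℕ
𝟙 true  = 1
𝟙 false = 0

∑ : List X → (X → ℕ) → ℕ
∑ L f = sum (map f L)

∑-cong : ∀ (L : List X) {f g : X → ℕ} → (∀ x → f x ≡ g x) → ∑ L f ≡ ∑ L g
∑-cong L f≗g = cong sum (map-cong f≗g L)

∑-zero : ∀ (L : List X) → ∑ L (λ _ → 0) ≡ 0
∑-zero []      = refl
∑-zero (_ ∷ L) = ∑-zero L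

∑-+ : ∀ (L : List X) (f g : X → ℕ) → ∑ L (λ x → f x + g x) ≡ ∑ L f + ∑ L g
∑-+ []      f g = refl
∑-+ (x ∷ L) f g = trans (cong (f x + g x +_) (∑-+ L f g))
                        (interchange +-commutativeSemigroup (f x) (g x) (∑ L f) (∑ L g))

∑-swap : ∀ (L : List X) (M : List Y) (g : X → Y → ℕ) →
         ∑ L (λ x → ∑ M (g x)) ≡ ∑ M (λ y → ∑ L (λ x → g x y))
∑-swap []      M g = sym (∑-zero M)
∑-swap (x ∷ L) M g = trans (cong (∑ M (g x) +_) (∑-swap L M g)) (sym (∑-+ M (g x) _))

∑-concatMap : ∀ (h : Y → List X) (L : List Y) (f : X → ℕ) →
              ∑ (concatMap h L) f ≡ ∑ L (λ y → ∑ (h y) f)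
∑-concatMap h []      f = refl
∑-concatMap h (y ∷ L) f = begin
  sum (map f (h y ++ concatMap h L))              ≡⟨ cong sum (map-++ f (h y) _) ⟩
  sum (map f (h y) ++ map f (concatMap h L))      ≡⟨ sum-++ (map f (h y)) _ ⟩
  ∑ (h y) f + ∑ (concatMap h L) f                 ≡⟨ cong (∑ (h y) f +_) (∑-concatMap h L f) ⟩
  ∑ (h y) f + ∑ L (λ y → ∑ (h y) f)               ∎

length-filter-≡true : ∀ (P : X → Bool) (L : List X) →
                      length (filter (λ x → P x Bool.≟ true) L) ≡ ∑ L (𝟙 ∘ P)
length-filter-≡true P []      = refl
length-filter-≡true P (x ∷ L) with P x
... | true  = cong suc (length-filter-≡true P L)
... | false = length-filter-≡true P L

module _ (L : List X) (R : X → X → Bool) (R-sym : ∀ x y → R x y ≡ R y x) where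

  private
    weight : (S T : X → Bool) → (∀ x → S x ≡ true → ∑ L (λ y → 𝟙 (T y ∧ R x y)) ≡ 1) →
             ∀ x → ∑ L (λ y → 𝟙 (S x ∧ T y ∧ R x y)) ≡ 𝟙 (S x)
    weight S T once x with S x in x∈S
    ... | true  = once x x∈S
    ... | false = ∑-zero L

  double-count : (S T : X → Bool) →
                 (∀ x → S x ≡ true → ∑ L (λ y → 𝟙 (T y ∧ R x y)) ≡ 1) →
                 (∀ y → T y ≡ true → ∑ L (λ x → 𝟙 (S x ∧ R y x)) ≡ 1) →
                 ∑ L (𝟙 ∘ S) ≡ ∑ L (𝟙 ∘ T)
  double-count S T S-once T-once = begin
    ∑ L (𝟙 ∘ S)                                   ≡⟨ ∑-cong L (weight S T S-once) ⟨
    ∑ L (λ x → ∑ L (λ y → 𝟙 (S x ∧ T y ∧ R x y))) ≡⟨ ∑-swap L L _ ⟩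
    ∑ L (λ y → ∑ L (λ x → 𝟙 (S x ∧ T y ∧ R x y))) ≡⟨ ∑-cong L (λ y → ∑-cong L (cong 𝟙 ∘ swap-ends y)) ⟩
    ∑ L (λ y → ∑ L (λ x → 𝟙 (T y ∧ S x ∧ R y x))) ≡⟨ ∑-cong L (weight T S T-once) ⟩
    ∑ L (𝟙 ∘ T)                                   ∎
    where
    swap-ends : ∀ y x → (S x ∧ T y ∧ R x y) ≡ (T y ∧ S x ∧ R y x)
    swap-ends y x =
      trans (x∙yz≈y∙xz (CommutativeMonoid.commutativeSemigroup ∧-commutativeMonoid) (S x) (T y) (R x y))
            (cong (λ b → T y ∧ S x ∧ b) (R-sym x y))

_≟ʷ_ : ∀ {n} → DecidableEquality (Word n)
_≟ʷ_ = ≡-dec _≟_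

∑-allWords-≟ : ∀ n (z : Word n) → ∑ (allWords n) (λ y → 𝟙 (does (y ≟ʷ z))) ≡ 1
∑-allWords-≟ zero    []      = refl
∑-allWords-≟ (suc n) (c ∷ z) = begin
  ∑ (allWords (suc n)) (λ y → 𝟙 (does (y ≟ʷ (c ∷ z))))                 ≡⟨ ∑-concatMap column (allWords n) _ ⟩
  ∑ (allWords n) (λ w → ∑ (column w) (λ y → 𝟙 (does (y ≟ʷ (c ∷ z)))))  ≡⟨ ∑-cong (allWords n) (column-count c) ⟩
  ∑ (allWords n) (λ w → 𝟙 (does (w ≟ʷ z)))                           ≡⟨ ∑-allWords-≟ n z ⟩
  1                                                                  ∎
  where
  column : Word n → List (Word (suc n))
  column w = map (_∷ w) (0F ∷ 1F ∷ 2F ∷ [])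

  column-count : ∀ c w → ∑ (column w) (λ y → 𝟙 (does (y ≟ʷ (c ∷ z)))) ≡ 𝟙 (does (w ≟ʷ z))
  column-count 0F w = +-identityʳ _
  column-count 1F w = +-identityʳ _
  column-count 2F w = +-identityʳ _

∑-allWords-∃! : ∀ {n} (P : Subset n) → ∃! _≡_ (λ y → P y ≡ true) → ∑ (allWords n) (𝟙 ∘ P) ≡ 1
∑-allWords-∃! {n} P (z , z∈P , unique) = trans (∑-cong (allWords n) indicator) (∑-allWords-≟ n z)
  where
  indicator : ∀ y → 𝟙 (P y) ≡ 𝟙 (does (y ≟ʷ z))
  indicator y with y ≟ʷ z
  ... | yes refl = cong 𝟙 z∈P
  ... | no y≢z with P y in y∈P
  ...   | true  = contradiction (sym (unique y∈P)) y≢z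
  ...   | false = refl

card≡∑ : ∀ {n} (U : Subset n) → card U ≡ ∑ (allWords n) (𝟙 ∘ U)
card≡∑ {n} U = length-filter-≡true U (allWords n)

adjᵇ : ∀ {n} → Word n → Word n → Bool
adjᵇ x y = ⌊ dist x y ℕ.≟ 1 ⌋

adjᵇ⇒Adj : ∀ {n} (x y : Word n) → adjᵇ x y ≡ true → Adj x y
adjᵇ⇒Adj x y x~y = toWitness (Equivalence.from T-≡ x~y)

Adj⇒adjᵇ : ∀ {n} (x y : Word n) → Adj x y → adjᵇ x y ≡ true
Adj⇒adjᵇ x y x~y = Equivalence.to T-≡ (fromWitness x~y)

adjᵇ-sym : ∀ {n} (x y : Word n) → adjᵇ x y ≡ adjᵇ y x
adjᵇ-sym x y = cong (λ d → ⌊ d ℕ.≟ 1 ⌋) (dist-sym x y)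

𝟙B+𝟙C≡1 : ∀ {n} (x : Word n) → residue x ≢ 0F → 𝟙 (B x) + 𝟙 (C x) ≡ 1
𝟙B+𝟙C≡1 x r≢0 =
  trans (cong₂ (λ b c → 𝟙 b + 𝟙 c) (isRes-toℕ 1F x) (isRes-toℕ 2F x)) (by-residue (residue x) r≢0)
  where
  by-residue : ∀ r → r ≢ 0F → 𝟙 ⌊ r ≟ 1F ⌋ + 𝟙 ⌊ r ≟ 2F ⌋ ≡ 1
  by-residue 0F r≢0 = contradiction refl r≢0
  by-residue 1F _   = refl
  by-residue 2F _   = refl

module _ {n} {U : Subset n} (U∌0 : ∀ x → U x ≡ true → residue x ≢ 0F) where

  card≡card-∩B+card-∩C : card U ≡ card (U ∩ B) + card (U ∩ C)
  card≡card-∩B+card-∩C = begin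
    card U                                                        ≡⟨ card≡∑ U ⟩
    ∑ (allWords n) (𝟙 ∘ U)                                        ≡⟨ ∑-cong (allWords n) split ⟩
    ∑ (allWords n) (λ x → 𝟙 ((U ∩ B) x) + 𝟙 ((U ∩ C) x))          ≡⟨ ∑-+ (allWords n) _ _ ⟩
    ∑ (allWords n) (𝟙 ∘ (U ∩ B)) + ∑ (allWords n) (𝟙 ∘ (U ∩ C))   ≡⟨ cong₂ _+_ (card≡∑ (U ∩ B)) (card≡∑ (U ∩ C)) ⟨
    card (U ∩ B) + card (U ∩ C)                                   ∎
    where
    split : ∀ x → 𝟙 (U x) ≡ 𝟙 ((U ∩ B) x) + 𝟙 ((U ∩ C) x)
    split x with U x in x∈U
    ... | true  = sym (𝟙B+𝟙C≡1 x (U∌0 x x∈U))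
    ... | false = refl

  card-∩B≡card-∩C : InducesPerfectMatching U → card (U ∩ B) ≡ card (U ∩ C)
  card-∩B≡card-∩C matching = begin
    card (U ∩ B)                    ≡⟨ card≡∑ (U ∩ B) ⟩
    ∑ (allWords n) (𝟙 ∘ (U ∩ B))    ≡⟨ double-count (allWords n) adjᵇ adjᵇ-sym (U ∩ B) (U ∩ C)
                                                      (partner-count 1F) (partner-count 2F) ⟩
    ∑ (allWords n) (𝟙 ∘ (U ∩ C))    ≡⟨ card≡∑ (U ∩ C) ⟨
    card (U ∩ C)                    ∎
    where
    partner-count : ∀ r x → (U ∩ isRes (toℕ r)) x ≡ true →
                    ∑ (allWords n) (λ y → 𝟙 ((U ∩ isRes (toℕ (- r))) y ∧ adjᵇ x y)) ≡ 1
    partner-count r x x∈ with matching x (∧-conicalˡ _ _ x∈)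
    ... | y , (x~y , y∈U) , unique =
      ∑-allWords-∃! _ (y , y-counted , λ z-counted →
        unique (z-adjacent z-counted , ∧-conicalˡ _ _ (∧-conicalˡ _ _ z-counted)))
      where
      residue-y : residue y ≡ - r
      residue-y = subst (λ s → residue y ≡ - s) (isRes⇒residue≡ r x (∧-conicalʳ _ _ x∈))
                        (distinct-nonzero⇒≡- (U∌0 x (∧-conicalˡ _ _ x∈)) (U∌0 y y∈U)
                                              (Adj⇒residue≢ x y x~y))

      y-counted : ((U ∩ isRes (toℕ (- r))) y ∧ adjᵇ x y) ≡ true
      y-counted = cong₂ _∧_ (cong₂ _∧_ y∈U (residue≡⇒isRes (- r) y residue-y))
                            (Adj⇒adjᵇ x y x~y)

      z-adjacent : ∀ {z} → ((U ∩ isRes (toℕ (- r))) z ∧ adjᵇ x z) ≡ true → Adj x z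
      z-adjacent {z} z-counted = adjᵇ⇒Adj x z (∧-conicalʳ ((U ∩ isRes (toℕ (- r))) z) _ z-counted)

lemma3p8 : (n : ℕ) (U : Subset (suc n)) → Isomorphic U (D (suc n))
    → (∀ x → A x ≡ true → U x ≡ false)
    → (card (U ∩ B) ≡ card (U ∩ C)) × (2 * card (U ∩ B) ≡ card U)
lemma3p8 n U (σ , U∘σ≗D) U∩A≡∅ = B≡C , (begin
  2 * card (U ∩ B)               ≡⟨ cong (card (U ∩ B) +_) (+-identityʳ _) ⟩
  card (U ∩ B) + card (U ∩ B)    ≡⟨ cong (card (U ∩ B) +_) B≡C ⟩
  card (U ∩ B) + card (U ∩ C)    ≡⟨ card≡card-∩B+card-∩C U∌0 ⟨
  card U                         ∎)
  where
  U∌0 : ∀ x → U x ≡ true → residue x ≢ 0F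
  U∌0 x x∈U r≡0 = contradiction (trans (sym x∈U) (U∩A≡∅ x (residue≡⇒isRes 0F x r≡0))) λ ()

  B≡C : card (U ∩ B) ≡ card (U ∩ C)
  B≡C = card-∩B≡card-∩C U∌0 (inducesPerfectMatching-pullback σ U∘σ≗D (D'-inducesPerfectMatching n))
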